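{- For every integer $k$, there is a matroid $M\in\mathcal E_3$ containing neither $I_3$ nor $F_7$ as an induced restriction such that $\chi(M)\ge k$.
   Context: A simple binary matroid (here just "matroid") is a pair $M=(E,G)$, where $G$ is identified with $\mathbb F_2^n\setminus\{0\}$ for some $n\ge0$ and $E\subseteq G$; $\dim(M)=n$. A flat of $G$ is a set $V\setminus\{0\}$ with $V$ a subspace of $\mathbb F_2^n$; its dimension is $\dim V$. $M$ contains $N=(F',G')$ as an induced restriction if there is an injective linear map $\varphi:G'\to G$ (linear on the underlying vector spaces) with $\varphi(F')=E\cap\varphi(G')$. The critical number $\chi(M)$ is the smallest $k\ge0$ such that $G\setminus E$ contains a flat of dimension $n-k$. $\mathcal E_3$ is the class of matroids $M=(E,G)$ such that $|E\cap F|$ is even for every flat $F$ of $G$ of dimension at least $3$. $I_3$ is the $3$-dimensional matroid whose ground set is a set of $3$ linearly independent vectors; $F_7=(G,G)$ with $G=\mathbb F_2^3\setminus\{0\}$. -}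

module Defs where

open import Data.Bool using (Bool; true; false; _xor_; if_then_else_; _∨_)
open import Data.Nat using (ℕ; zero; suc; _<_; _≤_)
open import Data.Nat.Divisibility using (_∣_)
open import Data.List using (List; []; _∷_; map; _++_)
open import Data.Nat.ListAction using (sum)
open import Data.Vec using (Vec; []; _∷_; zipWith; replicate)
open import Data.Product using (Σ; _×_)
open import Relation.Binary.PropositionalEquality using (_≡_)
open import Relation.Nullary using (¬_)
open import Function.Definitions using (Injective)

F2^ : ℕ → Set
F2^ n = Vec Bool n

_⊕_ : {n : ℕ} → F2^ n → F2^ n → F2^ n
_⊕_ = zipWith _xor_

0v : (n : ℕ) → F2^ n
0v n = replicate n false

-- Over F_2, a map is linear iff it is additive.
IsLinear : {m n : ℕ} → (F2^ m → F2^ n) → Set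
IsLinear f = ∀ x y → f (x ⊕ y) ≡ f x ⊕ f y

record InjLin (m n : ℕ) : Set where
  field
    map₀    : F2^ m → F2^ n
    linear  : IsLinear map₀
    inject  : Injective _≡_ _≡_ map₀
open InjLin public

-- A simple binary matroid M = (E, G): G = F_2^dim \ {0}, E ⊆ G given by
-- its (Boolean) characteristic function, which must vanish at 0.
record Matroid : Set where
  field
    dim    : ℕ
    E      : F2^ dim → Bool
    E-zero : E (0v dim) ≡ false
open Matroid public

-- M contains N as an induced restriction: an injective linear
-- φ : F_2^{dim N} → F_2^{dim M} with φ(F') = E ∩ φ(G'),
-- i.e. for every x, x ∈ F' iff φ x ∈ E.
ContainsInduced : Matroid → Matroid → Set
ContainsInduced M N =
  Σ (InjLin (dim N) (dim M)) λ φ → ∀ x → E N x ≡ E M (map₀ φ x)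

allVecs : (d : ℕ) → List (F2^ d)
allVecs zero = [] ∷ []
allVecs (suc d) = map (true ∷_) (allVecs d) ++ map (false ∷_) (allVecs d)

-- A flat of dimension d of G = F_2^n \ {0} is (V \ {0}) for V = image of an
-- injective linear map φ : F_2^d → F_2^n.  |E ∩ flat| is computed by counting
-- over the parametrisation (φ is injective; φ 0 = 0 ∉ E).
countInFlat : (M : Matroid) {d : ℕ} → InjLin d (dim M) → ℕ
countInFlat M {d} φ = sum (map (λ x → if E M (map₀ φ x) then 1 else 0) (allVecs d))

InE3 : Matroid → Set
InE3 M = ∀ (d : ℕ) → 3 ≤ d → (φ : InjLin d (dim M)) → 2 ∣ countInFlat M φ

ComplementHasFlat : Matroid → ℕ → Set
ComplementHasFlat M d = Σ (InjLin d (dim M)) λ φ → ∀ x → E M (map₀ φ x) ≡ false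

-- The condition in the definition of χ: G \ E contains a flat of dimension n - k
-- (truncated subtraction; for k ≥ n this is the empty flat of dimension 0).
χ-cond : Matroid → ℕ → Set
χ-cond M k = ComplementHasFlat M (dim M Data.Nat.∸ k)

IsCriticalNumber : Matroid → ℕ → Set
IsCriticalNumber M c = χ-cond M c × (∀ j → j < c → ¬ χ-cond M j)

isUnit : {n : ℕ} → F2^ n → Bool
isUnit [] = false
isUnit (true ∷ xs) = isZero xs
  where
    isZero : {m : ℕ} → F2^ m → Bool
    isZero [] = true
    isZero (true ∷ _) = false
    isZero (false ∷ ys) = isZero ys
isUnit (false ∷ xs) = isUnit xs

isNonzero : {n : ℕ} → F2^ n → Bool
isNonzero [] = false
isNonzero (b ∷ xs) = b ∨ isNonzero xs

I3 : Matroid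
I3 = record { dim = 3 ; E = isUnit ; E-zero = Relation.Binary.PropositionalEquality.refl }

F7 : Matroid
F7 = record { dim = 3 ; E = isNonzero ; E-zero = Relation.Binary.PropositionalEquality.refl }

-- The witness is the set of nonsingular vectors of the hyperbolic quadratic form
-- Q = x₁y₁ + ⋯ + x_k y_k on F₂^{2k}.  Q has degree 2, and a Boolean function of degree
-- less than d sums to zero over F₂^d; so on every flat of dimension at least 3 the
-- number of nonsingular vectors is even, i.e. the matroid lies in E₃.  Membership in
-- E₃ passes to induced restrictions, while I₃ and F₇ (3 and 7 elements in a flat of
-- dimension 3) are not in E₃.  Flats in the complement are totally singular subspaces;
-- the x-coordinate subspace is one of dimension k, and none is larger, because
-- splitting off a hyperbolic plane lowers the dimension of a totally singular
-- subspace by at most one.  Hence the critical number is exactly k.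
module Submission where

open import Defs
open import Data.Nat using (ℕ; _≤_)
open import Data.Product using (Σ; _×_)
open import Relation.Nullary using (¬_)

open import Data.Bool using (Bool; true; false; _xor_; _∧_; if_then_else_)
open import Data.Bool.Properties using (_≟_; xor-assoc; xor-same; xor-identityʳ; ∧-zeroʳ; xor-∧-commutativeRing)
open import Data.List using (List; []; _∷_; map; _++_)
open import Data.List.Properties using (map-cong)
open import Data.Nat using (zero; suc; _+_; _*_; _∸_; _<_; z≤n; s≤s)
open import Data.Nat.Divisibility using (_∣_; divides; _∣?_)
open import Data.Nat.ListAction using (sum)
open import Data.Nat.Properties using (≤-refl; +-suc; +-∸-assoc; m+n∸n≡m; m<m+n; m<n⇒0<n∸m; <⇒≤; <⇒≱)
open import Data.Product using (_,_; ∃)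
open import Data.Sum using (_⊎_; inj₁; inj₂)
open import Data.Vec using ([]; _∷_)
open import Data.Vec.Properties using (∷-injectiveˡ; ∷-injectiveʳ)
open import Function using (_∘_)
open import Function.Definitions using (Injective)
open import Relation.Binary.PropositionalEquality using (_≡_; _≗_; refl; sym; trans; cong; cong₂; subst; module ≡-Reasoning)
open import Relation.Nullary using (contradiction)
open import Relation.Nullary.Decidable using (dec⇒maybe; from-no)
open import Tactic.RingSolver using (solve-∀)
open import Tactic.RingSolver.Core.AlmostCommutativeRing using (AlmostCommutativeRing; fromCommutativeRing)

open ≡-Reasoning

-- Coefficients are tested against false, so the solver also cancels x xor x.
booleanRing : AlmostCommutativeRing _ _
booleanRing = fromCommutativeRing xor-∧-commutativeRing (λ b → dec⇒maybe (false ≟ b))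

⊕-identityˡ : ∀ {n} (v : F2^ n) → 0v n ⊕ v ≡ v
⊕-identityˡ []      = refl
⊕-identityˡ (b ∷ v) = cong (b ∷_) (⊕-identityˡ v)

⊕-identityʳ : ∀ {n} (v : F2^ n) → v ⊕ 0v n ≡ v
⊕-identityʳ []      = refl
⊕-identityʳ (b ∷ v) = cong₂ _∷_ (xor-identityʳ b) (⊕-identityʳ v)

⊕-self : ∀ {n} (v : F2^ n) → v ⊕ v ≡ 0v n
⊕-self []      = refl
⊕-self (b ∷ v) = cong₂ _∷_ (xor-same b) (⊕-self v)

⊕≡0⇒≡ : ∀ {n} {u v : F2^ n} → u ⊕ v ≡ 0v n → u ≡ v
⊕≡0⇒≡ {u = []}        {[]}        _  = refl
⊕≡0⇒≡ {u = true ∷ u}  {true ∷ v}  eq = cong (true ∷_) (⊕≡0⇒≡ (∷-injectiveʳ eq))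
⊕≡0⇒≡ {u = false ∷ u} {false ∷ v} eq = cong (false ∷_) (⊕≡0⇒≡ (∷-injectiveʳ eq))
⊕≡0⇒≡ {u = true ∷ u}  {false ∷ v} ()
⊕≡0⇒≡ {u = false ∷ u} {true ∷ v}  ()

F2^0-trivial : (x y : F2^ 0) → x ≡ y
F2^0-trivial [] [] = refl

linear-0 : ∀ {m n} {f : F2^ m → F2^ n} → IsLinear f → f (0v m) ≡ 0v n
linear-0 {m} {n} {f} lin = begin
  f (0v m)             ≡⟨ cong f (sym (⊕-self (0v m))) ⟩
  f (0v m ⊕ 0v m)      ≡⟨ lin (0v m) (0v m) ⟩
  f (0v m) ⊕ f (0v m)  ≡⟨ ⊕-self (f (0v m)) ⟩
  0v n                 ∎

trivialKernel⇒injective : ∀ {m n} {f : F2^ m → F2^ n} → IsLinear f →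
                          (∀ x → f x ≡ 0v n → x ≡ 0v m) → Injective _≡_ _≡_ f
trivialKernel⇒injective {n = n} {f} lin ker {x} {y} fx≡fy = ⊕≡0⇒≡ (ker (x ⊕ y) (begin
  f (x ⊕ y)  ≡⟨ lin x y ⟩
  f x ⊕ f y  ≡⟨ cong (_⊕ f y) fx≡fy ⟩
  f y ⊕ f y  ≡⟨ ⊕-self (f y) ⟩
  0v n       ∎))

injective⇒trivialKernel : ∀ {m n} (φ : InjLin m n) x → map₀ φ x ≡ 0v n → x ≡ 0v m
injective⇒trivialKernel φ x φx≡0 = inject φ (trans φx≡0 (sym (linear-0 (linear φ))))

idₗ : ∀ {n} → InjLin n n
idₗ = record { map₀ = λ x → x ; linear = λ _ _ → refl ; inject = λ eq → eq }

_∘ₗ_ : ∀ {l m n} → InjLin m n → InjLin l m → InjLin l n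
φ ∘ₗ ψ = record
  { map₀   = map₀ φ ∘ map₀ ψ
  ; linear = λ x y → trans (cong (map₀ φ) (linear ψ x y)) (linear φ (map₀ ψ x) (map₀ ψ y))
  ; inject = λ eq → inject ψ (inject φ eq)
  }

IsLinearForm : ∀ {n} → (F2^ n → Bool) → Set
IsLinearForm ℓ = ∀ u v → ℓ (u ⊕ v) ≡ ℓ u xor ℓ v

linearForm-∘ : ∀ {m n} {ℓ : F2^ n → Bool} {f : F2^ m → F2^ n} →
               IsLinearForm ℓ → IsLinear f → IsLinearForm (ℓ ∘ f)
linearForm-∘ {ℓ = ℓ} {f} ℓ-lin f-lin u v = trans (cong ℓ (f-lin u v)) (ℓ-lin (f u) (f v))

linearForm-0 : ∀ {n} (ℓ : F2^ n → Bool) → IsLinearForm ℓ → ℓ (0v n) ≡ false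
linearForm-0 {n} ℓ lin = begin
  ℓ (0v n)               ≡⟨ cong ℓ (sym (⊕-self (0v n))) ⟩
  ℓ (0v n ⊕ 0v n)        ≡⟨ lin (0v n) (0v n) ⟩
  ℓ (0v n) xor ℓ (0v n)  ≡⟨ xor-same (ℓ (0v n)) ⟩
  false                  ∎

linearForm-∷ : ∀ {n} (ℓ : F2^ (suc n) → Bool) → IsLinearForm ℓ →
               ∀ b v → ℓ (b ∷ v) ≡ ℓ (b ∷ 0v n) xor ℓ (false ∷ v)
linearForm-∷ {n} ℓ lin b v =
  trans (cong ℓ (sym (cong₂ _∷_ (xor-identityʳ b) (⊕-identityˡ v)))) (lin (b ∷ 0v n) (false ∷ v))

-- If ℓ(e₁) = 1 the kernel is the graph of v ↦ ℓ(0, v); otherwise ℓ ignores the first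
-- coordinate and we recurse on the remaining ones.
kernel-hyperplane : ∀ {d} (ℓ : F2^ (suc d) → Bool) → IsLinearForm ℓ →
                    Σ (InjLin d (suc d)) λ κ → ∀ v → ℓ (map₀ κ v) ≡ false
kernel-hyperplane {d} ℓ lin with ℓ (true ∷ 0v d) in ℓe₁
... | true = record { map₀ = κ ; linear = κ-linear ; inject = ∷-injectiveʳ } , ℓκ≡0
  where
  κ : F2^ d → F2^ (suc d)
  κ v = ℓ (false ∷ v) ∷ v
  κ-linear : IsLinear κ
  κ-linear u v = cong (_∷ (u ⊕ v)) (lin (false ∷ u) (false ∷ v))
  ℓ-head : ∀ b → ℓ (b ∷ 0v d) ≡ b
  ℓ-head true  = ℓe₁
  ℓ-head false = linearForm-0 ℓ lin
  ℓκ≡0 : ∀ v → ℓ (κ v) ≡ false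
  ℓκ≡0 v = begin
    ℓ (b ∷ v)               ≡⟨ linearForm-∷ ℓ lin b v ⟩
    ℓ (b ∷ 0v d) xor b      ≡⟨ cong (_xor b) (ℓ-head b) ⟩
    b xor b                 ≡⟨ xor-same b ⟩
    false                   ∎
    where b = ℓ (false ∷ v)
kernel-hyperplane {zero} ℓ lin | false =
  record { map₀ = λ _ → 0v 1 ; linear = λ _ _ → refl ; inject = λ { {[]} {[]} _ → refl } } ,
  λ _ → linearForm-0 ℓ lin
kernel-hyperplane {suc d} ℓ lin | false
  with kernel-hyperplane (ℓ ∘ (false ∷_)) (λ u v → lin (false ∷ u) (false ∷ v))
... | κ′ , ℓκ′≡0 = record { map₀ = κ ; linear = κ-linear ; inject = κ-injective } , ℓκ≡0
  where
  κ : F2^ (suc d) → F2^ (suc (suc d))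
  κ (a ∷ v) = a ∷ map₀ κ′ v
  κ-linear : IsLinear κ
  κ-linear (a ∷ u) (b ∷ v) = cong ((a xor b) ∷_) (linear κ′ u v)
  κ-injective : Injective _≡_ _≡_ κ
  κ-injective {a ∷ u} {b ∷ v} eq = cong₂ _∷_ (∷-injectiveˡ eq) (inject κ′ (∷-injectiveʳ eq))
  ℓ-head : ∀ b → ℓ (b ∷ 0v (suc d)) ≡ false
  ℓ-head true  = ℓe₁
  ℓ-head false = linearForm-0 ℓ lin
  ℓκ≡0 : ∀ v → ℓ (κ v) ≡ false
  ℓκ≡0 (a ∷ v) = trans (linearForm-∷ ℓ lin a (map₀ κ′ v)) (cong₂ _xor_ (ℓ-head a) (ℓκ′≡0 v))

allFalse-or-witness : ∀ n (P : F2^ n → Bool) → (∀ w → P w ≡ false) ⊎ ∃ λ w → P w ≡ true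
allFalse-or-witness zero P with P [] in P[]
... | false = inj₁ λ { [] → P[] }
... | true  = inj₂ ([] , P[])
allFalse-or-witness (suc n) P
  with allFalse-or-witness n (P ∘ (true ∷_)) | allFalse-or-witness n (P ∘ (false ∷_))
... | inj₂ (w , Pw) | _             = inj₂ (true ∷ w , Pw)
... | inj₁ _        | inj₂ (w , Pw) = inj₂ (false ∷ w , Pw)
... | inj₁ P₁≡0     | inj₁ P₀≡0     = inj₁ λ { (true ∷ w) → P₁≡0 w ; (false ∷ w) → P₀≡0 w }

xorSum : {A : Set} → List A → (A → Bool) → Bool
xorSum []       g = false
xorSum (x ∷ xs) g = g x xor xorSum xs g

xorSum-++ : ∀ {A : Set} (xs ys : List A) g → xorSum (xs ++ ys) g ≡ xorSum xs g xor xorSum ys g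
xorSum-++ []       ys g = refl
xorSum-++ (x ∷ xs) ys g =
  trans (cong (g x xor_) (xorSum-++ xs ys g)) (sym (xor-assoc (g x) (xorSum xs g) (xorSum ys g)))

xorSum-map : ∀ {A B : Set} (h : A → B) (xs : List A) g → xorSum (map h xs) g ≡ xorSum xs (g ∘ h)
xorSum-map h []       g = refl
xorSum-map h (x ∷ xs) g = cong (g (h x) xor_) (xorSum-map h xs g)

xorSum-xor : ∀ {A : Set} (xs : List A) f g →
             xorSum xs f xor xorSum xs g ≡ xorSum xs (λ x → f x xor g x)
xorSum-xor []       f g = refl
xorSum-xor (x ∷ xs) f g =
  trans (interchange (f x) (xorSum xs f) (g x) (xorSum xs g)) (cong ((f x xor g x) xor_) (xorSum-xor xs f g))
  where
  interchange : ∀ a b c d → (a xor b) xor (c xor d) ≡ (a xor c) xor (b xor d)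
  interchange = solve-∀ booleanRing

count : {A : Set} → List A → (A → Bool) → ℕ
count xs g = sum (map (λ x → if g x then 1 else 0) xs)

count≡xorSum+2q : ∀ {A : Set} (xs : List A) g →
                  ∃ λ q → count xs g ≡ (if xorSum xs g then 1 else 0) + q * 2
count≡xorSum+2q []       g = 0 , refl
count≡xorSum+2q (x ∷ xs) g with count≡xorSum+2q xs g
... | q , eq with g x | xorSum xs g
...   | true  | true  = suc q , cong (1 +_) eq
...   | true  | false = q , cong (1 +_) eq
...   | false | true  = q , eq
...   | false | false = q , eq

xorSum≡false⇒2∣count : ∀ {A : Set} (xs : List A) g → xorSum xs g ≡ false → 2 ∣ count xs g
xorSum≡false⇒2∣count xs g xorSum≡false with count≡xorSum+2q xs g
... | q , eq = divides q (trans eq (cong (λ b → (if b then 1 else 0) + q * 2) xorSum≡false))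

-- Discrete derivatives and algebraic degree

D : ∀ {n} → F2^ n → (F2^ n → Bool) → F2^ n → Bool
D a f x = f (x ⊕ a) xor f x

DegreeBelow : ∀ {n} → ℕ → (F2^ n → Bool) → Set
DegreeBelow zero    f = ∀ x → f x ≡ false
DegreeBelow (suc k) f = ∀ a → DegreeBelow k (D a f)

DegreeBelow-resp : ∀ {n} k {f g : F2^ n → Bool} → f ≗ g → DegreeBelow k f → DegreeBelow k g
DegreeBelow-resp zero    f≗g f≡0 x = trans (sym (f≗g x)) (f≡0 x)
DegreeBelow-resp (suc k) f≗g deg a =
  DegreeBelow-resp k (λ x → cong₂ _xor_ (f≗g (x ⊕ a)) (f≗g x)) (deg a)

DegreeBelow-zero : ∀ {n} k {f : F2^ n → Bool} → (∀ x → f x ≡ false) → DegreeBelow k f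
DegreeBelow-zero zero    f≡0   = f≡0
DegreeBelow-zero (suc k) f≡0 a = DegreeBelow-zero k (λ x → cong₂ _xor_ (f≡0 (x ⊕ a)) (f≡0 x))

DegreeBelow-mono : ∀ {n k l} {f : F2^ n → Bool} → k ≤ l → DegreeBelow k f → DegreeBelow l f
DegreeBelow-mono {l = l} z≤n       f≡0   = DegreeBelow-zero l f≡0
DegreeBelow-mono         (s≤s k≤l) deg a = DegreeBelow-mono k≤l (deg a)

DegreeBelow-∘ : ∀ {m n} k {f : F2^ n → Bool} {ψ : F2^ m → F2^ n} →
                IsLinear ψ → DegreeBelow k f → DegreeBelow k (f ∘ ψ)
DegreeBelow-∘ zero    {ψ = ψ} _   f≡0   x = f≡0 (ψ x)
DegreeBelow-∘ (suc k) {f} {ψ} lin deg a =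
  DegreeBelow-resp k (λ x → cong (λ y → f y xor f (ψ x)) (sym (lin x a)))
                     (DegreeBelow-∘ k lin (deg (ψ a)))

DegreeBelow-slice : ∀ {d} k {g : F2^ (suc d) → Bool} →
                    DegreeBelow (suc k) g → DegreeBelow k (λ v → g (true ∷ v) xor g (false ∷ v))
DegreeBelow-slice {d} k {g} deg =
  DegreeBelow-resp k (λ v → cong (λ y → g (true ∷ y) xor g (false ∷ v)) (⊕-identityʳ v))
                     (DegreeBelow-∘ k {ψ = false ∷_} (λ _ _ → refl) (deg (true ∷ 0v d)))

xorSum-allVecs-suc : ∀ {d} (g : F2^ (suc d) → Bool) →
                     xorSum (allVecs (suc d)) g ≡ xorSum (allVecs d) (λ v → g (true ∷ v) xor g (false ∷ v))
xorSum-allVecs-suc {d} g = begin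
  xorSum (map (true ∷_) (allVecs d) ++ map (false ∷_) (allVecs d)) g
    ≡⟨ xorSum-++ (map (true ∷_) (allVecs d)) (map (false ∷_) (allVecs d)) g ⟩
  xorSum (map (true ∷_) (allVecs d)) g xor xorSum (map (false ∷_) (allVecs d)) g
    ≡⟨ cong₂ _xor_ (xorSum-map (true ∷_) (allVecs d) g) (xorSum-map (false ∷_) (allVecs d) g) ⟩
  xorSum (allVecs d) (g ∘ (true ∷_)) xor xorSum (allVecs d) (g ∘ (false ∷_))
    ≡⟨ xorSum-xor (allVecs d) (g ∘ (true ∷_)) (g ∘ (false ∷_)) ⟩
  xorSum (allVecs d) (λ v → g (true ∷ v) xor g (false ∷ v))
    ∎

xorSum-DegreeBelow : ∀ d {g : F2^ d → Bool} → DegreeBelow d g → xorSum (allVecs d) g ≡ false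
xorSum-DegreeBelow zero    g≡0 = cong (_xor false) (g≡0 [])
xorSum-DegreeBelow (suc d) {g} deg =
  trans (xorSum-allVecs-suc g) (xorSum-DegreeBelow d (DegreeBelow-slice d {g = g} deg))

-- The hyperbolic quadratic form

twice : ℕ → ℕ
twice zero    = zero
twice (suc m) = suc (suc (twice m))

twice≡+ : ∀ m → twice m ≡ m + m
twice≡+ zero    = refl
twice≡+ (suc m) = cong suc (trans (cong suc (twice≡+ m)) (sym (+-suc m m)))

Q : (m : ℕ) → F2^ (twice m) → Bool
Q zero    []          = false
Q (suc m) (x ∷ y ∷ v) = (x ∧ y) xor Q m v

B : (m : ℕ) → F2^ (twice m) → F2^ (twice m) → Bool
B zero    []          []            = false
B (suc m) (x ∷ y ∷ u) (x′ ∷ y′ ∷ v) = ((x ∧ y′) xor (x′ ∧ y)) xor B m u v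

Q-0 : ∀ m → Q m (0v (twice m)) ≡ false
Q-0 zero    = refl
Q-0 (suc m) = Q-0 m

Q-polarization : ∀ m u v → Q m (u ⊕ v) ≡ (Q m u xor Q m v) xor B m u v
Q-polarization zero    []          []            = refl
Q-polarization (suc m) (x ∷ y ∷ u) (x′ ∷ y′ ∷ v) =
  trans (cong (((x xor x′) ∧ (y xor y′)) xor_) (Q-polarization m u v))
        (expand x x′ y y′ (Q m u) (Q m v) (B m u v))
  where
  expand : ∀ x x′ y y′ q q′ b →
           ((x xor x′) ∧ (y xor y′)) xor ((q xor q′) xor b)
           ≡ (((x ∧ y) xor q) xor ((x′ ∧ y′) xor q′)) xor (((x ∧ y′) xor (x′ ∧ y)) xor b)
  expand = solve-∀ booleanRing

B-additiveˡ : ∀ m u v w → B m (u ⊕ v) w ≡ B m u w xor B m v w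
B-additiveˡ zero    []          []            []            = refl
B-additiveˡ (suc m) (x ∷ y ∷ u) (x′ ∷ y′ ∷ v) (z ∷ z′ ∷ w) =
  trans (cong ((((x xor x′) ∧ z′) xor (z ∧ (y xor y′))) xor_) (B-additiveˡ m u v w))
        (expand x x′ y y′ z z′ (B m u w) (B m v w))
  where
  expand : ∀ x x′ y y′ z z′ b b′ →
           (((x xor x′) ∧ z′) xor (z ∧ (y xor y′))) xor (b xor b′)
           ≡ (((x ∧ z′) xor (z ∧ y)) xor b) xor (((x′ ∧ z′) xor (z ∧ y′)) xor b′)
  expand = solve-∀ booleanRing

D-Q : ∀ m c x → D c (Q m) x ≡ Q m c xor B m x c
D-Q m c x = trans (cong (_xor Q m x) (Q-polarization m x c)) (cancel (Q m x) (Q m c) (B m x c))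
  where
  cancel : ∀ q q′ b → ((q xor q′) xor b) xor q ≡ q′ xor b
  cancel = solve-∀ booleanRing

D²-Q : ∀ m b c x → D b (D c (Q m)) x ≡ B m b c
D²-Q m b c x = begin
  D c (Q m) (x ⊕ b) xor D c (Q m) x
    ≡⟨ cong₂ _xor_ (D-Q m c (x ⊕ b)) (D-Q m c x) ⟩
  (Q m c xor B m (x ⊕ b) c) xor (Q m c xor B m x c)
    ≡⟨ cong (λ t → (Q m c xor t) xor (Q m c xor B m x c)) (B-additiveˡ m x b c) ⟩
  (Q m c xor (B m x c xor B m b c)) xor (Q m c xor B m x c)
    ≡⟨ cancel (Q m c) (B m x c) (B m b c) ⟩
  B m b c
    ∎
  where
  cancel : ∀ q b b′ → (q xor (b xor b′)) xor (q xor b) ≡ b′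
  cancel = solve-∀ booleanRing

Q-DegreeBelow3 : ∀ m → DegreeBelow 3 (Q m)
Q-DegreeBelow3 m c b a x =
  trans (cong₂ _xor_ (D²-Q m b c (x ⊕ a)) (D²-Q m b c x)) (xor-same (B m b c))

hyperbolic : ℕ → Matroid
hyperbolic m = record { dim = twice m ; E = Q m ; E-zero = Q-0 m }

hyperbolic∈E3 : ∀ m → InE3 (hyperbolic m)
hyperbolic∈E3 m d 3≤d φ = xorSum≡false⇒2∣count (allVecs d) (Q m ∘ map₀ φ)
  (xorSum-DegreeBelow d (DegreeBelow-∘ d {f = Q m} (linear φ) (DegreeBelow-mono 3≤d (Q-DegreeBelow3 m))))

E3-induced : ∀ {M N} → ContainsInduced M N → InE3 M → InE3 N
E3-induced {M} {N} (φ , N≡M∘φ) M∈E3 d 3≤d ψ = subst (2 ∣_) (sym counts≡) (M∈E3 d 3≤d (φ ∘ₗ ψ))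
  where
  counts≡ : countInFlat N ψ ≡ countInFlat M (φ ∘ₗ ψ)
  counts≡ = cong sum (map-cong (λ x → cong (λ b → if b then 1 else 0) (N≡M∘φ (map₀ ψ x))) (allVecs d))

E3-excludes : ∀ {M N} → InE3 M → ¬ InE3 N → ¬ ContainsInduced M N
E3-excludes {M} {N} M∈E3 N∉E3 M⊇N = N∉E3 (E3-induced {M} {N} M⊇N M∈E3)

I3∉E3 : ¬ InE3 I3
I3∉E3 I3∈E3 = from-no (2 ∣? 3) (I3∈E3 3 ≤-refl idₗ)

F7∉E3 : ¬ InE3 F7
F7∉E3 F7∈E3 = from-no (2 ∣? 7) (F7∈E3 3 ≤-refl idₗ)

-- Totally singular subspaces of the hyperbolic form

coord₁ coord₂ : ∀ {n} → F2^ (suc (suc n)) → Bool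
coord₁ (x ∷ _ ∷ _) = x
coord₂ (_ ∷ y ∷ _) = y

rest : ∀ {n} → F2^ (suc (suc n)) → F2^ n
rest (_ ∷ _ ∷ v) = v

coord₁-linearForm : ∀ {n} → IsLinearForm (coord₁ {n})
coord₁-linearForm (_ ∷ _ ∷ _) (_ ∷ _ ∷ _) = refl

coord₂-linearForm : ∀ {n} → IsLinearForm (coord₂ {n})
coord₂-linearForm (_ ∷ _ ∷ _) (_ ∷ _ ∷ _) = refl

rest-linear : ∀ {n} → IsLinear (rest {n})
rest-linear (_ ∷ _ ∷ _) (_ ∷ _ ∷ _) = refl

≡-from-coords : ∀ {n} (x : F2^ (suc (suc n))) {a b r} →
                coord₁ x ≡ a → coord₂ x ≡ b → rest x ≡ r → x ≡ a ∷ b ∷ r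
≡-from-coords (_ ∷ _ ∷ _) refl refl refl = refl

Q-rest : ∀ {m} (x : F2^ (twice (suc m))) → coord₂ x ≡ false → Q (suc m) x ≡ Q m (rest x)
Q-rest {m} (x ∷ _ ∷ v) refl = cong (_xor Q m v) (∧-zeroʳ x)

e₁ : ∀ m → F2^ (twice (suc m))
e₁ m = true ∷ false ∷ 0v (twice m)

D-e₁-Q : ∀ {m} (x : F2^ (twice (suc m))) → D (e₁ m) (Q (suc m)) x ≡ coord₂ x
D-e₁-Q {m} (x ∷ y ∷ v) =
  trans (cong (λ u → (((x xor true) ∧ (y xor false)) xor Q m u) xor ((x ∧ y) xor Q m v)) (⊕-identityʳ v))
        (expand x y (Q m v))
  where
  expand : ∀ x y q → (((x xor true) ∧ (y xor false)) xor q) xor ((x ∧ y) xor q) ≡ y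
  expand = solve-∀ booleanRing

axis : ∀ m → F2^ m → F2^ (twice m)
axis zero    []      = []
axis (suc m) (x ∷ v) = x ∷ false ∷ axis m v

axis-singular : ∀ m → ComplementHasFlat (hyperbolic m) m
axis-singular m = record { map₀ = axis m ; linear = axis-linear m ; inject = axis-injective m } , axis-Q m
  where
  axis-linear : ∀ m → IsLinear (axis m)
  axis-linear zero    []      []      = refl
  axis-linear (suc m) (x ∷ u) (y ∷ v) = cong (λ w → (x xor y) ∷ false ∷ w) (axis-linear m u v)
  axis-injective : ∀ m → Injective _≡_ _≡_ (axis m)
  axis-injective zero    {[]}    {[]}    _  = refl
  axis-injective (suc m) {x ∷ u} {y ∷ v} eq = cong₂ _∷_ (∷-injectiveˡ eq) (axis-injective m (cong rest eq))
  axis-Q : ∀ m v → Q m (axis m v) ≡ false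
  axis-Q zero    []         = refl
  axis-Q (suc m) (true ∷ v)  = axis-Q m v
  axis-Q (suc m) (false ∷ v) = axis-Q m v

e₁∈singular⇒y₁≡0 : ∀ {m d} (φ : InjLin d (twice (suc m))) → (∀ v → Q (suc m) (map₀ φ v) ≡ false) →
                    ∀ s → map₀ φ s ≡ e₁ m → ∀ w → coord₂ (map₀ φ w) ≡ false
e₁∈singular⇒y₁≡0 {m} φ singular s φs≡e₁ w = begin
  coord₂ (map₀ φ w)
    ≡⟨ sym (D-e₁-Q (map₀ φ w)) ⟩
  Q (suc m) (map₀ φ w ⊕ e₁ m) xor Q (suc m) (map₀ φ w)
    ≡⟨ cong (λ u → Q (suc m) (map₀ φ w ⊕ u) xor Q (suc m) (map₀ φ w)) (sym φs≡e₁) ⟩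
  Q (suc m) (map₀ φ w ⊕ map₀ φ s) xor Q (suc m) (map₀ φ w)
    ≡⟨ cong (λ u → Q (suc m) u xor Q (suc m) (map₀ φ w)) (sym (linear φ w s)) ⟩
  Q (suc m) (map₀ φ (w ⊕ s)) xor Q (suc m) (map₀ φ w)
    ≡⟨ cong₂ _xor_ (singular (w ⊕ s)) (singular w) ⟩
  false
    ∎

-- Given y₁ = 0 on the subspace, the last hypothesis says that e₁ is not in it.
project-singular : ∀ {m d} (φ : InjLin d (twice (suc m))) →
                   (∀ v → Q (suc m) (map₀ φ v) ≡ false) →
                   (∀ v → coord₂ (map₀ φ v) ≡ false) →
                   (∀ v → rest (map₀ φ v) ≡ 0v (twice m) → coord₁ (map₀ φ v) ≡ false) →
                   ComplementHasFlat (hyperbolic m) d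
project-singular {m} φ singular y₁≡0 no-e₁ = π , π-singular
  where
  π-linear : IsLinear (rest ∘ map₀ φ)
  π-linear u v = trans (cong rest (linear φ u v)) (rest-linear (map₀ φ u) (map₀ φ v))
  π-kernel : ∀ v → rest (map₀ φ v) ≡ 0v (twice m) → v ≡ 0v _
  π-kernel v rest≡0 = injective⇒trivialKernel φ v (≡-from-coords (map₀ φ v) (no-e₁ v rest≡0) (y₁≡0 v) rest≡0)
  π : InjLin _ (twice m)
  π = record { map₀ = rest ∘ map₀ φ ; linear = π-linear ; inject = trivialKernel⇒injective π-linear π-kernel }
  π-singular : ∀ v → Q m (rest (map₀ φ v)) ≡ false
  π-singular v = trans (sym (Q-rest (map₀ φ v) (y₁≡0 v))) (singular v)

-- Restrict to the hyperplane y₁ = 0 of the subspace or, if y₁ already vanishes on it, to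
-- the hyperplane x₁ = 0.  In the former case e₁ is not in the restriction, for otherwise
-- D e₁ Q = y₁ would vanish on the whole subspace.
split-hyperbolicPlane : ∀ {m d} → ComplementHasFlat (hyperbolic (suc m)) (suc d) →
                        ComplementHasFlat (hyperbolic m) d
split-hyperbolicPlane {m} {d} (φ , singular) with allFalse-or-witness (suc d) (coord₂ ∘ map₀ φ)
... | inj₁ y₁≡0 with kernel-hyperplane (coord₁ ∘ map₀ φ) (linearForm-∘ {ℓ = coord₁} coord₁-linearForm (linear φ))
...   | κ , x₁κ≡0 = project-singular (φ ∘ₗ κ) (singular ∘ map₀ κ) (y₁≡0 ∘ map₀ κ) (λ v _ → x₁κ≡0 v)
split-hyperbolicPlane {m} {d} (φ , singular) | inj₂ (w , y₁w≡1)
  with kernel-hyperplane (coord₂ ∘ map₀ φ) (linearForm-∘ {ℓ = coord₂} coord₂-linearForm (linear φ))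
... | κ , y₁κ≡0 = project-singular (φ ∘ₗ κ) (singular ∘ map₀ κ) y₁κ≡0 no-e₁
  where
  no-e₁ : ∀ v → rest (map₀ φ (map₀ κ v)) ≡ 0v (twice m) → coord₁ (map₀ φ (map₀ κ v)) ≡ false
  no-e₁ v rest≡0 with coord₁ (map₀ φ (map₀ κ v)) in x₁≡1
  ... | false = refl
  ... | true  = contradiction (trans (sym y₁w≡1) (e₁∈singular⇒y₁≡0 φ singular (map₀ κ v) φκv≡e₁ w)) λ ()
    where
    φκv≡e₁ : map₀ φ (map₀ κ v) ≡ e₁ m
    φκv≡e₁ = ≡-from-coords (map₀ φ (map₀ κ v)) x₁≡1 (y₁κ≡0 v) rest≡0

singular-bound : ∀ m {d} → ComplementHasFlat (hyperbolic m) d → d ≤ m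
singular-bound m       {zero}  _       = z≤n
singular-bound zero    {suc d} (φ , _) =
  contradiction (inject φ (F2^0-trivial (map₀ φ (true ∷ 0v d)) (map₀ φ (0v (suc d))))) λ ()
singular-bound (suc m) {suc d} W       = s≤s (singular-bound m (split-hyperbolicPlane W))

hyperbolic-χ : ∀ m → IsCriticalNumber (hyperbolic m) m
hyperbolic-χ m = subst (ComplementHasFlat (hyperbolic m)) (sym twice∸m) (axis-singular m) , no-smaller
  where
  twice∸m : twice m ∸ m ≡ m
  twice∸m = trans (cong (_∸ m) (twice≡+ m)) (m+n∸n≡m m m)
  no-smaller : ∀ j → j < m → ¬ χ-cond (hyperbolic m) j
  no-smaller j j<m W = <⇒≱ m<twice∸j (singular-bound m W)
    where
    twice∸j : twice m ∸ j ≡ m + (m ∸ j)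
    twice∸j = trans (cong (_∸ j) (twice≡+ m)) (+-∸-assoc m (<⇒≤ j<m))
    m<twice∸j : m < twice m ∸ j
    m<twice∸j = subst (m <_) (sym twice∸j) (m<m+n m (m<n⇒0<n∸m j<m))

theorem1p3 : (k : ℕ) → Σ Matroid λ M →
    InE3 M × ¬ ContainsInduced M I3 × ¬ ContainsInduced M F7 ×
    Σ ℕ λ c → IsCriticalNumber M c × k ≤ c
theorem1p3 k =
  hyperbolic k , hyperbolic∈E3 k ,
  E3-excludes {hyperbolic k} {I3} (hyperbolic∈E3 k) I3∉E3 ,
  E3-excludes {hyperbolic k} {F7} (hyperbolic∈E3 k) F7∉E3 ,
  k , hyperbolic-χ k , ≤-refl
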